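{- Let $\Pi$ be a GSP of an SF instance $I=(A,\succ,c)$. Then every agent $a_i\in A$ is contained in at most one cyclic permutation of $\Pi$ of length greater than 2.
   Context: A Stable Fixtures (SF) instance is $I=(A,\succ,c)$ where $A=\{a_1,\dots,a_n\}$ is a finite set of $n$ agents; each agent $a_i$ has a strict linear order $\succ_i$ over $A\setminus\{a_i\}$ (complete preference list), with the convention that every agent ranks itself last ($a_j\succ_i a_i$ for all $j\neq i$); $a\succeq_i b$ means $a\succ_i b$ or $a=b$. Each agent has an integer capacity $c_i$ with $1\le c_i<n$. A cyclic permutation of a nonempty set $A_r\subseteq A$ is a permutation $\Pi_r$ of $A_r$ consisting of a single cycle of length $|A_r|$ (length 1: a fixed point $(a_i)$; length 2: a transposition $(a_i\ a_j)$). Two cyclic permutations are distinct if some element is mapped to different elements by them. A GSP (generalised stable partition) of $I$ is a finite collection $\Pi=\{\Pi_1,\dots,\Pi_k\}$ of cyclic permutations $\Pi_r$ of sets $A_r\subseteq A$, pairwise distinct except that fixed points may be repeated, such that: (F1) for every $r$ and every $a_j\in A_r$, $\Pi_r(a_j)\succeq_j\Pi_r^{ -1}(a_j)$; (F2) there are no distinct $a_i,a_j\in A$ with the transposition $(a_i\ a_j)\notin\Pi$ such that $a_j\succ_i\Pi_r^{ -1}(a_i)$ and $a_i\succ_j\Pi_s^{ -1}(a_j)$ for some $\Pi_r,\Pi_s\in\Pi$ with $a_i\in A_r$, $a_j\in A_s$; (F3) for every $a_i\in A$, the number of indices $r$ with $a_i\in A_r$ equals $c_i$; (F4) for all distinct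 $a_i,a_j\in A$, $|\{s:\Pi_s(a_i)=a_j\}|+|\{s:\Pi_s(a_j)=a_i\}|\le 2$. -}

module Defs where

open import Data.Nat using (ℕ; zero; suc; _+_; _≤_; _<_; NonZero)
open import Data.Nat.DivMod using (_mod_)
open import Data.Fin using (Fin; toℕ)
open import Data.Fin.Properties using (any?)
open import Data.List using (List; length; filter; allFin)
open import Data.Product using (Σ; ∃; _×_; _,_)
open import Data.Sum using (_⊎_)
open import Relation.Binary.PropositionalEquality using (_≡_; _≢_)
open import Relation.Nullary using (¬_; Dec)
open import Relation.Nullary.Decidable using (_×-dec_)
open import Function.Definitions using (Injective)
open import Function.Bundles using (_⇔_)

-- An SF instance: each agent i has a strict linear order ≻ᵢ on agents,
-- encoded by an injective rank function (smaller rank = more preferred),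
-- in which i itself is ranked last; and a capacity 1 ≤ cᵢ < n.
record SF (n : ℕ) : Set where
  field
    rank      : Fin n → Fin n → ℕ
    rank-inj  : ∀ i → Injective _≡_ _≡_ (rank i)
    self-last : ∀ i j → j ≢ i → rank i j < rank i i
    cap       : Fin n → ℕ
    cap-pos   : ∀ i → 1 ≤ cap i
    cap-lt    : ∀ i → cap i < n

module _ {n : ℕ} (I : SF n) where
  open SF I
  Prefers : Fin n → Fin n → Fin n → Set
  Prefers i a b = rank i a < rank i b
  PrefersEq : Fin n → Fin n → Fin n → Set
  PrefersEq i a b = rank i a ≤ rank i b

-- A cyclic permutation of a nonempty set A_r ⊆ A: the cycle
-- (x₀ x₁ … x_m) given by an injective x : Fin (suc m) → Fin n,
-- mapping x_p ↦ x_{p+1 mod (m+1)}.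
record Cycle (n : ℕ) : Set where
  constructor cycle
  field
    m     : ℕ
    elems : Fin (suc m) → Fin n
    inj   : Injective _≡_ _≡_ elems

module _ {n : ℕ} where
  open Cycle

  len : Cycle n → ℕ
  len C = suc (m C)

  next : (C : Cycle n) → Fin (suc (m C)) → Fin (suc (m C))
  next C p = suc (toℕ p) mod suc (m C)

  prev : (C : Cycle n) → Fin (suc (m C)) → Fin (suc (m C))
  prev C p = (toℕ p + m C) mod suc (m C)

  _∈C_ : Fin n → Cycle n → Set
  a ∈C C = ∃ λ p → elems C p ≡ a

  _∈C?_ : (a : Fin n) → (C : Cycle n) → Dec (a ∈C C)
  a ∈C? C = any? (λ p → elems C p Data.Fin.≟ a)

  MapsTo : Cycle n → Fin n → Fin n → Set
  MapsTo C a b = ∃ λ p → elems C p ≡ a × elems C (next C p) ≡ b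

  MapsTo? : (C : Cycle n) → (a b : Fin n) → Dec (MapsTo C a b)
  MapsTo? C a b = any? (λ p → (elems C p Data.Fin.≟ a) ×-dec (elems C (next C p) Data.Fin.≟ b))

  SamePerm : Cycle n → Cycle n → Set
  SamePerm C D = (∀ a → (a ∈C C) ⇔ (a ∈C D))
               × (∀ p q → elems C p ≡ elems D q → elems C (next C p) ≡ elems D (next D q))

  IsTransposition : Cycle n → Fin n → Fin n → Set
  IsTransposition C a b = len C ≡ 2 × (a ∈C C) × (b ∈C C)

module _ {n k : ℕ} (Π : Fin k → Cycle n) where
  open Cycle

  countMember : Fin n → ℕ
  countMember a = length (filter (λ r → a ∈C? Π r) (allFin k))

  countMaps : Fin n → Fin n → ℕ
  countMaps a b = length (filter (λ r → MapsTo? (Π r) a b) (allFin k))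

  TranspositionIn : Fin n → Fin n → Set
  TranspositionIn a b = ∃ λ r → IsTransposition (Π r) a b

  record IsGSP (I : SF n) : Set where
    open SF I
    field
      -- pairwise distinct, except that fixed points may be repeated
      distinct : ∀ r s → r ≢ s → 2 ≤ len (Π r) → ¬ SamePerm (Π r) (Π s)
      F1 : ∀ r p → PrefersEq I (elems (Π r) p)
                                (elems (Π r) (next (Π r) p))
                                (elems (Π r) (prev (Π r) p))
      F2 : ∀ i j → i ≢ j → ¬ TranspositionIn i j →
           ∀ r p s q → elems (Π r) p ≡ i → elems (Π s) q ≡ j →
           ¬ (Prefers I i j (elems (Π r) (prev (Π r) p))
              × Prefers I j i (elems (Π s) (prev (Π s) q)))
      F3 : ∀ i → countMember i ≡ cap i
      F4 : ∀ i j → i ≢ j → countMaps i j + countMaps j i ≤ 2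

-- If a lay on two
-- long cycles with different predecessors y and y′, say with y ≻ₐ y′, then y
-- strictly prefers its successor a to its own predecessor (F1 is strict on a
-- cycle of length > 2, where successor and predecessor differ), so {y, a}
-- would block by (F2) -- unless the transposition (y a) belongs to Π, which
-- (F4) forbids since Π would then map y to a twice and a to y once. Walking
-- backwards around the cycle, the two cycles coincide, contradicting the
-- distinctness of the members of Π.
module Submission where

open import Data.Empty using (⊥-elim)
open import Data.Fin using (Fin; toℕ; zero; suc; _≟_)
open import Data.Fin.Properties using (toℕ-injective; toℕ≤pred[n]; toℕ<n; toℕ-fromℕ<)
open import Data.List using (List; length)
open import Data.List.Membership.Propositional using (_∈_)
open import Data.List.Membership.Propositional.Properties using (∈-filter⁺; ∈-allFin; ∈-length)
open import Data.List.Relation.Unary.Any using (here; there)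
open import Data.Nat hiding (_≟_)
import Data.Nat as ℕ
open import Data.Nat.DivMod using (_mod_; _%_; m%n<n; m<n⇒m%n≡m; n%n≡0; [m+n]%n≡m%n)
open import Data.Nat.Properties hiding (_≟_)
open import Data.Product using (∃; _,_)
open import Data.Sum using (inj₁; inj₂)
open import Function using (_∘_)
open import Function.Bundles using (mk⇔)
open import Relation.Binary using (tri<; tri≈; tri>)
open import Relation.Binary.PropositionalEquality
open import Relation.Nullary using (yes; no; ¬_)

open import Defs

-- `next C` and `prev C` unfold to `cycSuc (m C)` and `cycPred (m C)`.
module CyclicFin (m : ℕ) where

  cycSuc : Fin (suc m) → Fin (suc m)
  cycSuc p = suc (toℕ p) mod suc m

  cycPred : Fin (suc m) → Fin (suc m)
  cycPred p = (toℕ p + m) mod suc m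

  private
    toℕ-mod : ∀ a → toℕ (a mod suc m) ≡ a % suc m
    toℕ-mod a = toℕ-fromℕ< (m%n<n a (suc m))

  toℕ-cycSuc-< : ∀ {p} → toℕ p < m → toℕ (cycSuc p) ≡ suc (toℕ p)
  toℕ-cycSuc-< {p} p<m = trans (toℕ-mod (suc (toℕ p))) (m<n⇒m%n≡m (s≤s p<m))

  toℕ-cycSuc-last : ∀ {p} → toℕ p ≡ m → toℕ (cycSuc p) ≡ 0
  toℕ-cycSuc-last {p} p≡m = begin
    toℕ (cycSuc p)      ≡⟨ toℕ-mod (suc (toℕ p)) ⟩
    suc (toℕ p) % suc m ≡⟨ cong (λ t → suc t % suc m) p≡m ⟩
    suc m % suc m       ≡⟨ n%n≡0 (suc m) ⟩
    0                   ∎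
    where open ≡-Reasoning

  toℕ-cycPred-zero : ∀ {p} → toℕ p ≡ 0 → toℕ (cycPred p) ≡ m
  toℕ-cycPred-zero {p} p≡0 = begin
    toℕ (cycPred p)     ≡⟨ toℕ-mod (toℕ p + m) ⟩
    (toℕ p + m) % suc m ≡⟨ cong (λ t → (t + m) % suc m) p≡0 ⟩
    m % suc m           ≡⟨ m<n⇒m%n≡m ≤-refl ⟩
    m                   ∎
    where open ≡-Reasoning

  toℕ-cycPred-suc : ∀ {p j} → toℕ p ≡ suc j → toℕ (cycPred p) ≡ j
  toℕ-cycPred-suc {p} {j} p≡1+j = begin
    toℕ (cycPred p)       ≡⟨ toℕ-mod (toℕ p + m) ⟩
    (toℕ p + m) % suc m   ≡⟨ cong (λ t → (t + m) % suc m) p≡1+j ⟩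
    (suc j + m) % suc m   ≡⟨ cong (_% suc m) (sym (+-suc j m)) ⟩
    (j + suc m) % suc m   ≡⟨ [m+n]%n≡m%n j (suc m) ⟩
    j % suc m             ≡⟨ m<n⇒m%n≡m j<1+m ⟩
    j                     ∎
    where
    open ≡-Reasoning
    j<1+m : j < suc m
    j<1+m = m≤n⇒m≤1+n (subst (_≤ m) p≡1+j (toℕ≤pred[n] p))

  cycPred-cycSuc : ∀ p → cycPred (cycSuc p) ≡ p
  cycPred-cycSuc p with m≤n⇒m<n∨m≡n (toℕ≤pred[n] p)
  ... | inj₁ p<m = toℕ-injective (toℕ-cycPred-suc (toℕ-cycSuc-< p<m))
  ... | inj₂ p≡m = toℕ-injective (trans (toℕ-cycPred-zero (toℕ-cycSuc-last p≡m)) (sym p≡m))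

  cycSuc-cycPred : ∀ p → cycSuc (cycPred p) ≡ p
  cycSuc-cycPred zero    = toℕ-injective (toℕ-cycSuc-last (toℕ-cycPred-zero refl))
  cycSuc-cycPred (suc q) = toℕ-injective (begin
    toℕ (cycSuc (cycPred (suc q))) ≡⟨ toℕ-cycSuc-< (subst (_< m) (sym pred≡q) (toℕ<n q)) ⟩
    suc (toℕ (cycPred (suc q)))    ≡⟨ cong suc pred≡q ⟩
    suc (toℕ q)                    ∎)
    where
    open ≡-Reasoning
    pred≡q : toℕ (cycPred (suc q)) ≡ toℕ q
    pred≡q = toℕ-cycPred-suc refl

  cycPred≢id : 1 ≤ m → ∀ p → cycPred p ≢ p
  cycPred≢id 1≤m zero    pred≡p = <⇒≢ 1≤m (trans (sym (cong toℕ pred≡p)) (toℕ-cycPred-zero refl))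
  cycPred≢id 1≤m (suc q) pred≡p = 1+n≢n (trans (sym (cong toℕ pred≡p)) (toℕ-cycPred-suc refl))

  cycSuc≢cycPred : 2 ≤ m → ∀ p → cycSuc p ≢ cycPred p
  cycSuc≢cycPred 2≤m zero suc≡pred = <⇒≢ 2≤m (begin
    1                    ≡⟨ sym (toℕ-cycSuc-< (≤-trans (s≤s z≤n) 2≤m)) ⟩
    toℕ (cycSuc zero)    ≡⟨ cong toℕ suc≡pred ⟩
    toℕ (cycPred zero)   ≡⟨ toℕ-cycPred-zero refl ⟩
    m                    ∎)
    where open ≡-Reasoning
  cycSuc≢cycPred 2≤m (suc q) suc≡pred with m≤n⇒m<n∨m≡n (toℕ<n q)
  ... | inj₁ 1+q<m = <⇒≢ (m<n⇒m<1+n (n<1+n (toℕ q))) (sym (begin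
    suc (suc (toℕ q))     ≡⟨ sym (toℕ-cycSuc-< 1+q<m) ⟩
    toℕ (cycSuc (suc q))  ≡⟨ cong toℕ suc≡pred ⟩
    toℕ (cycPred (suc q)) ≡⟨ toℕ-cycPred-suc refl ⟩
    toℕ q                 ∎))
    where open ≡-Reasoning
  ... | inj₂ 1+q≡m = <⇒≢ 2≤m (begin
    1                           ≡⟨ cong suc (sym (toℕ-cycSuc-last 1+q≡m)) ⟩
    suc (toℕ (cycSuc (suc q)))  ≡⟨ cong (suc ∘ toℕ) suc≡pred ⟩
    suc (toℕ (cycPred (suc q))) ≡⟨ cong suc (toℕ-cycPred-suc refl) ⟩
    suc (toℕ q)                 ≡⟨ 1+q≡m ⟩
    m                           ∎)
    where open ≡-Reasoning

  module _ (Q : Fin (suc m) → Set) (closed : ∀ p → Q p → Q (cycPred p)) where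
    private
      downward : ∀ i {p} → toℕ p ≡ i → Q p → ∀ p′ → toℕ p′ ≤ i → Q p′
      downward zero    p≡0 Qp p′ p′≤0 = subst Q (toℕ-injective (trans p≡0 (sym (n≤0⇒n≡0 p′≤0)))) Qp
      downward (suc j) {p} p≡ Qp p′ p′≤ with toℕ p′ ℕ.≟ suc j
      ... | yes p′≡ = subst Q (toℕ-injective (trans p≡ (sym p′≡))) Qp
      ... | no  p′≢ = downward j (toℕ-cycPred-suc p≡) (closed p Qp) p′ (s≤s⁻¹ (≤∧≢⇒< p′≤ p′≢))

    cycPred-closed⇒universal : ∀ {p₀} → Q p₀ → ∀ p → Q p
    cycPred-closed⇒universal {p₀} Qp₀ p =
      downward m (toℕ-cycPred-zero refl) (closed zero Q-zero) p (toℕ≤pred[n] p)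
      where
      Q-zero : Q zero
      Q-zero = downward (toℕ p₀) refl Qp₀ zero z≤n

distinct-∈⇒2≤length : ∀ {A : Set} {x y : A} {xs : List A} → x ∈ xs → y ∈ xs → x ≢ y → 2 ≤ length xs
distinct-∈⇒2≤length (here refl)  (here refl)  x≢y = ⊥-elim (x≢y refl)
distinct-∈⇒2≤length (here refl)  (there y∈xs) _   = s≤s (∈-length y∈xs)
distinct-∈⇒2≤length (there x∈xs) (here refl)  _   = s≤s (∈-length x∈xs)
distinct-∈⇒2≤length (there x∈xs) (there y∈xs) x≢y = m≤n⇒m≤1+n (distinct-∈⇒2≤length x∈xs y∈xs x≢y)

module _ {n : ℕ} where
  open Cycle

  len≡2⇒next≡other : (C : Cycle n) → len C ≡ 2 → ∀ {u v} → u ≢ v → next C u ≡ v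
  len≡2⇒next≡other (cycle .1 _ _) refl {zero}     {zero}     u≢v = ⊥-elim (u≢v refl)
  len≡2⇒next≡other (cycle .1 _ _) refl {zero}     {suc zero} _   = refl
  len≡2⇒next≡other (cycle .1 _ _) refl {suc zero} {zero}     _   = refl
  len≡2⇒next≡other (cycle .1 _ _) refl {suc zero} {suc zero} u≢v = ⊥-elim (u≢v refl)

  IsTransposition-sym : ∀ (C : Cycle n) {a b} → IsTransposition C a b → IsTransposition C b a
  IsTransposition-sym _ (len≡2 , a∈C , b∈C) = len≡2 , b∈C , a∈C

  IsTransposition⇒MapsTo : ∀ (C : Cycle n) {a b} → IsTransposition C a b → a ≢ b → MapsTo C a b
  IsTransposition⇒MapsTo C (len≡2 , (u , u↦a) , (v , v↦b)) a≢b =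
    u , u↦a , trans (cong (elems C) (len≡2⇒next≡other C len≡2 u≢v)) v↦b
    where
    u≢v : u ≢ v
    u≢v u≡v = a≢b (trans (sym u↦a) (trans (cong (elems C) u≡v) v↦b))

module _ {n k : ℕ} {I : SF n} {Π : Fin k → Cycle n} (gsp : IsGSP Π I) where
  open SF I
  open IsGSP gsp
  open Cycle

  private
    at : (r : Fin k) → Fin (len (Π r)) → Fin n
    at r = elems (Π r)

  F1-strict : ∀ {r} → 2 < len (Π r) → ∀ p →
              Prefers I (at r p) (at r (next (Π r) p)) (at r (prev (Π r) p))
  F1-strict {r} 2<len p = ≤∧≢⇒< (F1 r p) λ eq →
    CyclicFin.cycSuc≢cycPred (m (Π r)) (s≤s⁻¹ 2<len) p (inj (Π r) (rank-inj (at r p) eq))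

  long-edge⇒¬TranspositionIn : ∀ {r y a} → 2 < len (Π r) → MapsTo (Π r) y a → y ≢ a →
                               ¬ TranspositionIn Π y a
  long-edge⇒¬TranspositionIn {r} {y} {a} 2<len r:y↦a y≢a (t , t:y⇄a@(len≡2 , _)) =
    <⇒≱ (+-mono-≤ 2≤y↦a 1≤a↦y) (F4 y a y≢a)
    where
    r≢t : r ≢ t
    r≢t refl = <⇒≢ 2<len (sym len≡2)
    2≤y↦a : 2 ≤ countMaps Π y a
    2≤y↦a = distinct-∈⇒2≤length
      (∈-filter⁺ (λ u → MapsTo? (Π u) y a) (∈-allFin r) r:y↦a)
      (∈-filter⁺ (λ u → MapsTo? (Π u) y a) (∈-allFin t) (IsTransposition⇒MapsTo (Π t) t:y⇄a y≢a))
      r≢t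
    1≤a↦y : 1 ≤ countMaps Π a y
    1≤a↦y = ∈-length (∈-filter⁺ (λ u → MapsTo? (Π u) a y) (∈-allFin t)
                        (IsTransposition⇒MapsTo (Π t) (IsTransposition-sym (Π t) t:y⇄a) (≢-sym y≢a)))

  ¬prefers-prev-over-prev : ∀ {r s p q} → 2 < len (Π r) → at r p ≡ at s q →
                            ¬ Prefers I (at r p) (at r (prev (Π r) p)) (at s (prev (Π s) q))
  ¬prefers-prev-over-prev {r} {s} {p} {q} 2<len a≡ a-prefers-y =
    F2 y a y≢a (long-edge⇒¬TranspositionIn 2<len y↦a y≢a)
       r (prev (Π r) p) s q refl (sym a≡) (y-prefers-a , a-prefers-y)
    where
    open CyclicFin (m (Π r))
    a y : Fin n
    a = at r p
    y = at r (prev (Π r) p)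
    y≢a : y ≢ a
    y≢a y≡a = cycPred≢id (≤-trans (s≤s z≤n) (s≤s⁻¹ 2<len)) p (inj (Π r) y≡a)
    y↦a : MapsTo (Π r) y a
    y↦a = prev (Π r) p , refl , cong (at r) (cycSuc-cycPred p)
    y-prefers-a : Prefers I y a (at r (prev (Π r) (prev (Π r) p)))
    y-prefers-a = subst (λ p′ → Prefers I y (at r p′) (at r (prev (Π r) (prev (Π r) p))))
                        (cycSuc-cycPred p) (F1-strict 2<len (prev (Π r) p))

  prev-agree : ∀ {r s p q} → 2 < len (Π r) → 2 < len (Π s) → at r p ≡ at s q →
               at r (prev (Π r) p) ≡ at s (prev (Π s) q)
  prev-agree {r} {s} {p} {q} 2<len-r 2<len-s a≡
    with <-cmp (rank (at r p) (at r (prev (Π r) p))) (rank (at r p) (at s (prev (Π s) q)))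
  ... | tri< r-better _ _  = ⊥-elim (¬prefers-prev-over-prev 2<len-r a≡ r-better)
  ... | tri≈ _ same-rank _ = rank-inj (at r p) same-rank
  ... | tri> _ _ s-better  = ⊥-elim (¬prefers-prev-over-prev 2<len-s (sym a≡)
      (subst (λ a → Prefers I a (at s (prev (Π s) q)) (at r (prev (Π r) p))) a≡ s-better))

  shared-agent⇒⊆ : ∀ {r s p₀ q₀} → 2 < len (Π r) → 2 < len (Π s) → at r p₀ ≡ at s q₀ →
                   ∀ p → ∃ λ q → at r p ≡ at s q
  shared-agent⇒⊆ {r} {s} {q₀ = q₀} 2<len-r 2<len-s a≡ =
    CyclicFin.cycPred-closed⇒universal (m (Π r)) (λ p → ∃ λ q → at r p ≡ at s q)
      (λ p (q , p≡q) → prev (Π s) q , prev-agree 2<len-r 2<len-s p≡q) (q₀ , a≡)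

  shared-agent⇒SamePerm : ∀ {r s p₀ q₀} → 2 < len (Π r) → 2 < len (Π s) → at r p₀ ≡ at s q₀ →
                          SamePerm (Π r) (Π s)
  shared-agent⇒SamePerm {r} {s} 2<len-r 2<len-s a≡ = (λ b → mk⇔ (r⊆s b) (s⊆r b)) , next-agree
    where
    r⊆s : ∀ b → b ∈C Π r → b ∈C Π s
    r⊆s b (p , p↦b) with shared-agent⇒⊆ 2<len-r 2<len-s a≡ p
    ... | q , p≡q = q , trans (sym p≡q) p↦b
    s⊆r : ∀ b → b ∈C Π s → b ∈C Π r
    s⊆r b (q , q↦b) with shared-agent⇒⊆ 2<len-s 2<len-r (sym a≡) q
    ... | p , q≡p = p , trans (sym q≡p) q↦b
    next-agree : ∀ p q → at r p ≡ at s q → at r (next (Π r) p) ≡ at s (next (Π s) q)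
    next-agree p q p≡q with shared-agent⇒⊆ 2<len-r 2<len-s a≡ (next (Π r) p)
    ... | q′ , next≡q′ = trans next≡q′ (cong (at s) (sym next-q≡q′))
      where
      q≡prev-q′ : q ≡ prev (Π s) q′
      q≡prev-q′ = inj (Π s) (begin
        at s q                             ≡⟨ sym p≡q ⟩
        at r p                             ≡⟨ cong (at r) (sym (CyclicFin.cycPred-cycSuc (m (Π r)) p)) ⟩
        at r (prev (Π r) (next (Π r) p))   ≡⟨ prev-agree 2<len-r 2<len-s next≡q′ ⟩
        at s (prev (Π s) q′)               ∎)
        where open ≡-Reasoning
      next-q≡q′ : next (Π s) q ≡ q′
      next-q≡q′ = trans (cong (next (Π s)) q≡prev-q′) (CyclicFin.cycSuc-cycPred (m (Π s)) q′)

theorem5 : ∀ {n k} (I : SF n) (Π : Fin k → Cycle n) → IsGSP Π I →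
           ∀ (a : Fin n) (r s : Fin k) → 2 < len (Π r) → 2 < len (Π s) →
           a ∈C Π r → a ∈C Π s → r ≡ s
theorem5 I Π gsp _ r s 2<len-r 2<len-s (p , p↦a) (q , q↦a) with r ≟ s
... | yes r≡s = r≡s
... | no  r≢s = ⊥-elim (IsGSP.distinct gsp r s r≢s (<⇒≤ 2<len-r)
                  (shared-agent⇒SamePerm gsp 2<len-r 2<len-s (trans p↦a (sym q↦a))))
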